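{- For every real $0<\alpha<1$, the set $B_\alpha$ is finite. For every real $\alpha\ge 1$, the set $B_\alpha$ is infinite.
   Context: For a positive integer $n$, its complexity $\|n\|$ is the least number of $1$'s needed to write $n$ using only the constant $1$, addition, multiplication, and parentheses (so $\|1\|=1$ and for $n>1$, $\|n\|=\min\{\|a\|+\|b\|: a,b<n,\ a+b=n \text{ or } ab=n\}$). The defect is $\delta(n)=\|n\|-3\log_3 n$. A positive integer $n$ is a leader if it is not the case that $3\mid n$ and $\|n\|=3+\|n/3\|$. For real $r\ge 0$, $B_r$ is the set of leaders $n$ with $\delta(n)<r$.
   Formalization: The threshold α is a rational a/b with natural a and b, in both the finiteness and the infiniteness claim, rather than an arbitrary real. -}

module Defs where

open import Data.Nat using (ℕ; zero; suc; _+_; _*_; _^_; _≤_; _<_)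
open import Data.Product using (Σ; _×_; ∃; _,_)
open import Relation.Binary.PropositionalEquality using (_≡_)
open import Relation.Nullary using (¬_)

data Expr : Set where
  one : Expr
  add : Expr → Expr → Expr
  mul : Expr → Expr → Expr

eval : Expr → ℕ
eval one       = 1
eval (add e f) = eval e + eval f
eval (mul e f) = eval e * eval f

ones : Expr → ℕ
ones one       = 1
ones (add e f) = ones e + ones f
ones (mul e f) = ones e + ones f

Complexity : ℕ → ℕ → Set
Complexity n k = (Σ Expr λ e → eval e ≡ n × ones e ≡ k)
               × (∀ (e : Expr) → eval e ≡ n → k ≤ ones e)

Leader : ℕ → Set
Leader n = ¬ (Σ ℕ λ m → n ≡ 3 * m × Σ ℕ λ k → Complexity m k × Complexity n (3 + k))

-- For a rational r = a / b (b > 0):  δ(n) < a/b, where ‖n‖ = k, i.e.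
--   k - 3 log₃ n < a / b   ⟺   3^(b k) < 3^a · n^(3 b).
DefectBelow : ℕ → ℕ → ℕ → Set
DefectBelow a b n = Σ ℕ λ k → Complexity n k × (3 ^ (b * k) < 3 ^ a * n ^ (3 * b))

InB : ℕ → ℕ → ℕ → Set
InB a b n = Leader n × DefectBelow a b n

FiniteSet : (ℕ → Set) → Set
FiniteSet P = Σ ℕ λ N → ∀ n → P n → n < N

InfiniteSet : (ℕ → Set) → Set
InfiniteSet P = ∀ N → Σ ℕ λ n → N ≤ n × P n

{-# OPTIONS --safe #-}
-- For an expression of n with k ones put C = 3^k, so that its defect is
-- log₃ (C / n³); by induction on expressions n³ ≤ C.
--
-- For a/b ≥ 1: the numbers 3^m + 1 are leaders, being prime to 3, of complexity
-- 3m + 1, hence of defect 1 − 3 log₃ (1 + 3^(−m)) < 1.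
--
-- For a/b < 1 put X = 7 + 6b. A sum x + y ≥ X has defect at least a/b: when a
-- summand is 1 because (1 + 1/y)^(3b) ≤ 2 < 3^(1 − a/b), otherwise because
-- 3 (x + y)³ ≤ C_x C_y. A sum below X other than 3 has defect at least
-- 3 log₃ (9/8). Defects add up along products, so an optimal expression of
-- defect below a/b is 3, or spends three 1's on a factor 3 (and then its value
-- is no leader), or is a product of r sums below X with r ≤ 9, as
-- (9/8)^10 > 3. Every element of B_{a/b} is therefore at most X^9.
module Submission where

open import Defs
open import Data.Nat using (ℕ; _≤_; _<_)
open import Data.Product using (_×_)

open import Data.Nat
  using (zero; suc; _+_; _*_; _^_; NonZero; >-nonZero; z≤n; s≤s; z<s; _≟_; _≤?_)
open import Data.Nat.Properties
open import Data.Nat.Divisibility using (_∣_; divides; ∣1⇒≡1; ∣m+n∣m⇒∣n; m∣m*n)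
open import Data.Nat.Tactic.RingSolver using (solve-∀)
open import Data.Product using (∃; _,_)
open import Data.List using (List; []; _∷_; _++_; filter; cartesianProductWith)
open import Data.List.Membership.Propositional using (_∈_)
open import Data.List.Membership.Propositional.Properties
  using (∈-++⁺ˡ; ∈-++⁺ʳ; ∈-cartesianProductWith⁺; ∈-filter⁺)
open import Data.List.Relation.Unary.Any using (here; there)
open import Data.List.Relation.Unary.All using (lookup)
open import Data.List.Relation.Unary.All.Properties using (all-filter)
open import Data.List.Extrema.Nat using (argmin; argmin-all; f[argmin]≤f[⊤]; f[argmin]≤f[xs])
open import Relation.Binary.PropositionalEquality
  using (_≡_; _≢_; refl; sym; trans; cong; cong₂; subst; subst₂; module ≡-Reasoning)
open import Algebra.Properties.CommutativeSemigroup *-commutativeSemigroup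
  using ()
  renaming (interchange to *-interchange; x∙yz≈y∙xz to x*[y*z]≡y*[x*z]; xy∙z≈y∙xz to [x*y]*z≡y*[x*z])
open import Algebra.Properties.CommutativeSemigroup +-commutativeSemigroup
  using () renaming (xy∙z≈xz∙y to [x+y]+z≡[x+z]+y)
open import Relation.Nullary using (¬_; yes; no; contradiction)

cube : ℕ → ℕ
cube x = x * x * x

cube-mono-≤ : ∀ {x y} → x ≤ y → cube x ≤ cube y
cube-mono-≤ x≤y = *-mono-≤ (*-mono-≤ x≤y x≤y) x≤y

cube-mono-< : ∀ {x y} → x < y → cube x < cube y
cube-mono-< x<y = *-mono-< (*-mono-< x<y x<y) x<y

cube-* : ∀ x y → cube (x * y) ≡ cube x * cube y
cube-* = expand
  where
  expand : ∀ x y → x * y * (x * y) * (x * y) ≡ x * x * x * (y * y * y)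
  expand = solve-∀

^-distribʳ-* : ∀ m n o → (m * n) ^ o ≡ m ^ o * n ^ o
^-distribʳ-* m n zero    = refl
^-distribʳ-* m n (suc o) = begin
  m * n * (m * n) ^ o      ≡⟨ cong (m * n *_) (^-distribʳ-* m n o) ⟩
  m * n * (m ^ o * n ^ o)  ≡⟨ *-interchange m n (m ^ o) (n ^ o) ⟩
  m * m ^ o * (n * n ^ o)  ∎
  where open ≡-Reasoning

^-3*≡cube-^ : ∀ n b → n ^ (3 * b) ≡ cube n ^ b
^-3*≡cube-^ n b = trans (sym (^-*-assoc n 3 b)) (cong (_^ b) (n^3≡cube n))
  where
  n^3≡cube : ∀ n → n * (n * (n * 1)) ≡ n * n * n
  n^3≡cube = solve-∀

^-*≡^-^ : ∀ m b k → m ^ (b * k) ≡ (m ^ k) ^ b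
^-*≡^-^ m b k = trans (cong (m ^_) (*-comm b k)) (sym (^-*-assoc m k b))

^-cancelʳ-< : ∀ m .{{_ : NonZero m}} {n o} → m ^ n < m ^ o → n < o
^-cancelʳ-< m mⁿ<mᵒ = ≰⇒> λ o≤n → <⇒≱ mⁿ<mᵒ (^-monoʳ-≤ m o≤n)

m+n≡o⇒m≤o : ∀ {m o} n → m + n ≡ o → m ≤ o
m+n≡o⇒m≤o n eq = m+n≤o⇒m≤o _ {n} (≤-reflexive eq)

[1+m+t]^m*t≤[m+t]^m*[m+t] : ∀ m t → suc (m + t) ^ m * t ≤ (m + t) ^ m * (m + t)
[1+m+t]^m*t≤[m+t]^m*[m+t] zero    t = ≤-refl
[1+m+t]^m*t≤[m+t]^m*[m+t] (suc m) t = begin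
  suc x * P * t        ≡⟨ [x*y]*z≡y*[x*z] (suc x) P t ⟩
  P * (suc x * t)      ≤⟨ *-monoʳ-≤ P (+-monoˡ-≤ (x * t) t≤x) ⟩
  P * (x + x * t)      ≡⟨ reassocʳ P x t ⟩
  P * suc t * x        ≤⟨ *-monoˡ-≤ x ih ⟩
  x ^ m * x * x        ≡⟨ cong (_* x) (*-comm (x ^ m) x) ⟩
  x * x ^ m * x        ∎
  where
  open ≤-Reasoning
  x = suc (m + t)
  P = suc x ^ m
  ih : P * suc t ≤ x ^ m * x
  ih = subst (λ u → suc u ^ m * suc t ≤ u ^ m * u) (+-suc m t) ([1+m+t]^m*t≤[m+t]^m*[m+t] m (suc t))
  t≤x : t ≤ x
  t≤x = ≤-trans (m≤n+m t m) (n≤1+n _)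
  reassocʳ : ∀ p x t → p * (x + x * t) ≡ p * (1 + t) * x
  reassocʳ = solve-∀

[1+y]^m≤2*y^m : ∀ m y → 2 * m ≤ y → suc y ^ m ≤ 2 * y ^ m
[1+y]^m≤2*y^m zero    y _    = s≤s z≤n
[1+y]^m≤2*y^m (suc k) y 2m≤y with m≤n⇒∃[o]m+o≡n (m+n≤o⇒m≤o (suc k) 2m≤y)
... | t , refl = *-cancelʳ-≤ _ _ t {{>-nonZero (<-≤-trans z<s m≤t)}} (begin
  suc (m + t) ^ m * t      ≤⟨ [1+m+t]^m*t≤[m+t]^m*[m+t] m t ⟩
  (m + t) ^ m * (m + t)    ≤⟨ *-monoʳ-≤ ((m + t) ^ m) (+-monoˡ-≤ t m≤t) ⟩
  (m + t) ^ m * (t + t)    ≡⟨ double ((m + t) ^ m) t ⟩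
  2 * (m + t) ^ m * t      ∎)
  where
  open ≤-Reasoning
  m = suc k
  m≤t : m ≤ t
  m≤t = +-cancelˡ-≤ m m t (subst (_≤ m + t) (cong (m +_) (+-identityʳ m)) 2m≤y)
  double : ∀ q t → q * (t + t) ≡ 2 * q * t
  double = solve-∀

3*8^r≤9^r : ∀ {r} → 10 ≤ r → 3 * 8 ^ r ≤ 9 ^ r
3*8^r≤9^r 10≤r with m≤n⇒∃[o]m+o≡n 10≤r
... | t , refl = from10 t
  where
  from10 : ∀ t → 3 * 8 ^ (10 + t) ≤ 9 ^ (10 + t)
  from10 zero    = ≤ᵇ⇒≤ (3 * 8 ^ 10) (9 ^ 10) _
  from10 (suc t) = begin
    3 * (8 * 8 ^ (10 + t))   ≡⟨ x*[y*z]≡y*[x*z] 3 8 (8 ^ (10 + t)) ⟩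
    8 * (3 * 8 ^ (10 + t))   ≤⟨ *-mono-≤ (≤ᵇ⇒≤ 8 9 _) (from10 t) ⟩
    9 * 9 ^ (10 + t)         ∎
    where open ≤-Reasoning

-- cube x ≤ A is not preserved by addition on its own (1 + 1, 1 + 2); the
-- lower bounds on A, which hold for A = 3^k, repair those cases.
record CubeBound (x A : ℕ) : Set where
  field
    positive : 1 ≤ x
    cube≤    : cube x ≤ A
    3≤       : 3 ≤ A
    9≤       : 2 ≤ x → 9 ≤ A
open CubeBound

cubeBound-* : ∀ {x y A B} → CubeBound x A → CubeBound y B → CubeBound (x * y) (A * B)
cubeBound-* {x} {y} {A} {B} xA yB = record
  { positive = *-mono-≤ (positive xA) (positive yB)
  ; cube≤    = subst (_≤ A * B) (sym (cube-* x y)) (*-mono-≤ (cube≤ xA) (cube≤ yB))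
  ; 3≤       = ≤-trans (3≤ xA) (m≤m*n A B {{>-nonZero (<-≤-trans z<s (3≤ yB))}})
  ; 9≤       = λ _ → *-mono-≤ (3≤ xA) (3≤ yB)
  }

cube-1+≤ : ∀ y {A B} → CubeBound 1 A → CubeBound y B → cube (1 + y) ≤ A * B
cube-1+≤ zero                _  yB with () ← positive yB
cube-1+≤ (suc zero)          xA yB = ≤-trans (≤ᵇ⇒≤ 8 9 _) (*-mono-≤ (3≤ xA) (3≤ yB))
cube-1+≤ (suc (suc zero))    xA yB = *-mono-≤ (3≤ xA) (9≤ yB (s≤s (s≤s z≤n)))
cube-1+≤ (suc (suc (suc t))) xA yB =
  ≤-trans (m+n≡o⇒m≤o _ (expand t)) (*-mono-≤ (3≤ xA) (cube≤ yB))
  where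
  expand : ∀ t → (4 + t) * (4 + t) * (4 + t) + (17 + 33 * t + 15 * (t * t) + 2 * (t * t * t))
               ≡ 3 * ((3 + t) * (3 + t) * (3 + t))
  expand = solve-∀

[2+s]+[2+t]≤[2+s]*[2+t] : ∀ s t → (2 + s) + (2 + t) ≤ (2 + s) * (2 + t)
[2+s]+[2+t]≤[2+s]*[2+t] s t = m+n≡o⇒m≤o _ (expand s t)
  where
  expand : ∀ s t → (2 + s) + (2 + t) + (s + t + s * t) ≡ (2 + s) * (2 + t)
  expand = solve-∀

cube-+≤ : ∀ x y {A B} → CubeBound x A → CubeBound y B → cube (x + y) ≤ A * B
cube-+≤ zero                y             xA _  with () ← positive xA
cube-+≤ (suc zero)          y             xA yB = cube-1+≤ y xA yB
cube-+≤ (suc (suc s))       zero          _  yB with () ← positive yB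
cube-+≤ (suc (suc s))       (suc zero) {A} {B} xA yB =
  subst₂ (λ u v → cube u ≤ v) (+-comm 1 (2 + s)) (*-comm B A) (cube-1+≤ (2 + s) yB xA)
cube-+≤ (suc (suc s))       (suc (suc t)) {A} {B} xA yB = begin
  cube (2 + s + (2 + t))     ≤⟨ cube-mono-≤ ([2+s]+[2+t]≤[2+s]*[2+t] s t) ⟩
  cube ((2 + s) * (2 + t))   ≡⟨ cube-* (2 + s) (2 + t) ⟩
  cube (2 + s) * cube (2 + t) ≤⟨ *-mono-≤ (cube≤ xA) (cube≤ yB) ⟩
  A * B                      ∎
  where open ≤-Reasoning

cubeBound-+ : ∀ {x y A B} → CubeBound x A → CubeBound y B → CubeBound (x + y) (A * B)
cubeBound-+ {x} {y} {A} {B} xA yB = record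
  { positive = ≤-trans (positive xA) (m≤m+n x y)
  ; cube≤    = cube-+≤ x y xA yB
  ; 3≤       = ≤-trans (3≤ xA) (m≤m*n A B {{>-nonZero (<-≤-trans z<s (3≤ yB))}})
  ; 9≤       = λ _ → *-mono-≤ (3≤ xA) (3≤ yB)
  }

cubeBound-eval : ∀ e → CubeBound (eval e) (3 ^ ones e)
cubeBound-eval one = record { positive = s≤s z≤n ; cube≤ = s≤s z≤n ; 3≤ = ≤-refl ; 9≤ = λ { (s≤s ()) } }
cubeBound-eval (add e f) =
  subst (CubeBound _) (sym (^-distribˡ-+-* 3 (ones e) (ones f))) (cubeBound-+ (cubeBound-eval e) (cubeBound-eval f))
cubeBound-eval (mul e f) =
  subst (CubeBound _) (sym (^-distribˡ-+-* 3 (ones e) (ones f))) (cubeBound-* (cubeBound-eval e) (cubeBound-eval f))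

3≤ones-if-eval≡3 : ∀ e → eval e ≡ 3 → 3 ≤ ones e
3≤ones-if-eval≡3 e eval≡3 =
  ^-cancelʳ-< 3 {2} (<-≤-trans (≤ᵇ⇒≤ 10 27 _)
    (subst (λ n → cube n ≤ 3 ^ ones e) eval≡3 (cube≤ (cubeBound-eval e))))

27*cube-+≤8*cube-* : ∀ s t → 27 * cube (3 + s + (3 + t)) ≤ 8 * cube ((3 + s) * (3 + t))
27*cube-+≤8*cube-* s t = subst₂ _≤_ (cube-3* (3 + s + (3 + t))) (cube-2* ((3 + s) * (3 + t)))
  (cube-mono-≤ {3 * (3 + s + (3 + t))} (m+n≡o⇒m≤o _ (expand s t)))
  where
  expand : ∀ s t → 3 * (3 + s + (3 + t)) + (3 * s + 3 * t + 2 * (s * t)) ≡ 2 * ((3 + s) * (3 + t))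
  expand = solve-∀
  cube-3* : ∀ v → 3 * v * (3 * v) * (3 * v) ≡ 27 * (v * v * v)
  cube-3* = solve-∀
  cube-2* : ∀ v → 2 * v * (2 * v) * (2 * v) ≡ 8 * (v * v * v)
  cube-2* = solve-∀

9*cube-1+≤8* : ∀ y {A B} → CubeBound 1 A → CubeBound y B → 1 + y ≢ 3 → 9 * cube (1 + y) ≤ 8 * (A * B)
9*cube-1+≤8* zero                _  yB _  with () ← positive yB
9*cube-1+≤8* (suc zero)          xA yB _  = *-monoʳ-≤ 8 (*-mono-≤ (3≤ xA) (3≤ yB))
9*cube-1+≤8* (suc (suc zero))    _  _  ≢3 = contradiction refl ≢3
9*cube-1+≤8* (suc (suc (suc t))) xA yB _  =
  ≤-trans (m+n≡o⇒m≤o _ (expand t)) (*-monoʳ-≤ 8 (*-mono-≤ (3≤ xA) (cube≤ yB)))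
  where
  expand : ∀ t → 9 * ((4 + t) * (4 + t) * (4 + t)) + (72 + 216 * t + 108 * (t * t) + 15 * (t * t * t))
               ≡ 8 * (3 * ((3 + t) * (3 + t) * (3 + t)))
  expand = solve-∀

9*cube-2+≤8* : ∀ y {A B} → CubeBound 2 A → CubeBound y B → 2 ≤ y → 9 * cube (2 + y) ≤ 8 * (A * B)
9*cube-2+≤8* (suc zero)          _  _  (s≤s ())
9*cube-2+≤8* (suc (suc zero))    xA yB _ =
  ≤-trans (≤ᵇ⇒≤ 576 648 _) (*-monoʳ-≤ 8 (*-mono-≤ (9≤ xA (s≤s (s≤s z≤n))) (9≤ yB (s≤s (s≤s z≤n)))))
9*cube-2+≤8* (suc (suc (suc t))) xA yB _ =
  ≤-trans (m+n≡o⇒m≤o _ (expand t)) (*-monoʳ-≤ 8 (*-mono-≤ (cube≤ xA) (cube≤ yB)))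
  where
  expand : ∀ t → 9 * ((5 + t) * (5 + t) * (5 + t)) + (603 + 1053 * t + 441 * (t * t) + 55 * (t * t * t))
               ≡ 8 * (8 * ((3 + t) * (3 + t) * (3 + t)))
  expand = solve-∀

9*cube-+≤8* : ∀ x y {A B} → CubeBound x A → CubeBound y B → x + y ≢ 3 → 9 * cube (x + y) ≤ 8 * (A * B)
9*cube-+≤8* zero                y                   xA _  _  with () ← positive xA
9*cube-+≤8* (suc zero)          y                   xA yB ≢3 = 9*cube-1+≤8* y xA yB ≢3
9*cube-+≤8* (suc (suc s))       zero                _  yB _  with () ← positive yB
9*cube-+≤8* (suc (suc s))       (suc zero) {A} {B}  xA yB ≢3 =
  subst₂ (λ u v → 9 * cube u ≤ 8 * v) (+-comm 1 (2 + s)) (*-comm B A)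
    (9*cube-1+≤8* (2 + s) yB xA (λ eq → ≢3 (trans (+-comm (2 + s) 1) eq)))
9*cube-+≤8* (suc (suc zero))    (suc (suc t))       xA yB _  = 9*cube-2+≤8* (2 + t) xA yB (s≤s (s≤s z≤n))
9*cube-+≤8* (suc (suc (suc s))) (suc (suc zero)) {A} {B} xA yB _ =
  subst₂ (λ u v → 9 * cube u ≤ 8 * v) (+-comm 2 (3 + s)) (*-comm B A)
    (9*cube-2+≤8* (3 + s) yB xA (s≤s (s≤s z≤n)))
9*cube-+≤8* (suc (suc (suc s))) (suc (suc (suc t))) {A} {B} xA yB _ = begin
  9 * cube (3 + s + (3 + t))        ≤⟨ *-monoˡ-≤ (cube (3 + s + (3 + t))) (≤ᵇ⇒≤ 9 27 _) ⟩
  27 * cube (3 + s + (3 + t))       ≤⟨ 27*cube-+≤8*cube-* s t ⟩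
  8 * cube ((3 + s) * (3 + t))      ≡⟨ cong (8 *_) (cube-* (3 + s) (3 + t)) ⟩
  8 * (cube (3 + s) * cube (3 + t)) ≤⟨ *-monoʳ-≤ 8 (*-mono-≤ (cube≤ xA) (cube≤ yB)) ⟩
  8 * (A * B)                       ∎
  where open ≤-Reasoning

3*cube-2+≤ : ∀ y {A B} → CubeBound 2 A → CubeBound y B → 5 ≤ y → 3 * cube (2 + y) ≤ A * B
3*cube-2+≤ y xA yB 5≤y with m≤n⇒∃[o]m+o≡n 5≤y
... | t , refl = ≤-trans (m+n≡o⇒m≤o _ (expand t)) (*-mono-≤ (9≤ xA (s≤s (s≤s z≤n))) (cube≤ yB))
  where
  expand : ∀ t → 3 * ((7 + t) * (7 + t) * (7 + t)) + (96 + 234 * t + 72 * (t * t) + 6 * (t * t * t))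
               ≡ 9 * ((5 + t) * (5 + t) * (5 + t))
  expand = solve-∀

3*cube-+≤ : ∀ x y {A B} → CubeBound x A → CubeBound y B → 2 ≤ x → 2 ≤ y → 7 ≤ x + y →
            3 * cube (x + y) ≤ A * B
3*cube-+≤ (suc zero) _ _ _ (s≤s ()) _ _
3*cube-+≤ (suc (suc zero)) y xA yB _ _ 7≤x+y = 3*cube-2+≤ y xA yB (≤-pred (≤-pred 7≤x+y))
3*cube-+≤ (suc (suc (suc s))) (suc zero) _ _ _ (s≤s ()) _
3*cube-+≤ (suc (suc (suc s))) (suc (suc zero)) {A} {B} xA yB _ _ 7≤x+y =
  subst₂ (λ u v → 3 * cube u ≤ v) (+-comm 2 (3 + s)) (*-comm B A)
    (3*cube-2+≤ (3 + s) yB xA (≤-pred (≤-pred (subst (7 ≤_) (+-comm (3 + s) 2) 7≤x+y))))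
3*cube-+≤ (suc (suc (suc s))) (suc (suc (suc t))) {A} {B} xA yB _ _ _ = *-cancelˡ-≤ 9 (begin
  9 * (3 * cube (3 + s + (3 + t)))  ≡⟨ *-assoc 9 3 (cube (3 + s + (3 + t))) ⟨
  27 * cube (3 + s + (3 + t))       ≤⟨ 27*cube-+≤8*cube-* s t ⟩
  8 * cube ((3 + s) * (3 + t))      ≤⟨ *-monoˡ-≤ (cube ((3 + s) * (3 + t))) (≤ᵇ⇒≤ 8 9 _) ⟩
  9 * cube ((3 + s) * (3 + t))      ≡⟨ cong (9 *_) (cube-* (3 + s) (3 + t)) ⟩
  9 * (cube (3 + s) * cube (3 + t)) ≤⟨ *-monoʳ-≤ 9 (*-mono-≤ (cube≤ xA) (cube≤ yB)) ⟩
  9 * (A * B)                       ∎)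
  where open ≤-Reasoning

ones-positive : ∀ e → 1 ≤ ones e
ones-positive one       = s≤s z≤n
ones-positive (add e f) = ≤-trans (ones-positive e) (m≤m+n (ones e) (ones f))
ones-positive (mul e f) = ≤-trans (ones-positive e) (m≤m+n (ones e) (ones f))

exprsWithin : ℕ → List Expr
exprsWithin zero    = []
exprsWithin (suc d) = one ∷ cartesianProductWith add es es ++ cartesianProductWith mul es es
  where es = exprsWithin d

operands-within : ∀ e f {d} → ones e + ones f ≤ suc d → ones e ≤ d × ones f ≤ d
operands-within e f ones≤ =
  ≤-pred (<-≤-trans (m<m+n (ones e) (ones-positive f)) ones≤) ,
  ≤-pred (<-≤-trans (m<n+m (ones f) (ones-positive e)) ones≤)

∈-exprsWithin : ∀ e {d} → ones e ≤ d → e ∈ exprsWithin d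
∈-exprsWithin e         {zero}  ones≤0 with () ← ≤-trans (ones-positive e) ones≤0
∈-exprsWithin one       {suc d} _      = here refl
∈-exprsWithin (add e f) {suc d} ones≤ =
  let e≤ , f≤ = operands-within e f ones≤ in
  there (∈-++⁺ˡ (∈-cartesianProductWith⁺ add (∈-exprsWithin e e≤) (∈-exprsWithin f f≤)))
∈-exprsWithin (mul e f) {suc d} ones≤ =
  let e≤ , f≤ = operands-within e f ones≤ in
  there (∈-++⁺ʳ (cartesianProductWith add (exprsWithin d) (exprsWithin d))
    (∈-cartesianProductWith⁺ mul (∈-exprsWithin e e≤) (∈-exprsWithin f f≤)))

complexity-exists : ∀ e → ∃ (Complexity (eval e))
complexity-exists e = ones best , (best , evalBest , refl) , bestMinimal
  where
  candidates : List Expr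
  candidates = filter (λ e′ → eval e′ ≟ eval e) (exprsWithin (ones e))
  best : Expr
  best = argmin ones e candidates
  evalBest : eval best ≡ eval e
  evalBest = argmin-all ones refl (all-filter (λ e′ → eval e′ ≟ eval e) (exprsWithin (ones e)))
  bestMinimal : ∀ e′ → eval e′ ≡ eval e → ones best ≤ ones e′
  bestMinimal e′ eq with ones e′ ≤? ones e
  ... | yes e′≤e = lookup (f[argmin]≤f[xs] {f = ones} e candidates)
                     (∈-filter⁺ (λ e′ → eval e′ ≟ eval e) (∈-exprsWithin e′ e′≤e) eq)
  ... | no  e′≰e = ≤-trans (f[argmin]≤f[⊤] {f = ones} e candidates) (<⇒≤ (≰⇒> e′≰e))

three : Expr
three = add one (add one one)

Optimal : Expr → Set
Optimal e = ∀ e′ → eval e′ ≡ eval e → ones e ≤ ones e′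

leader-if-3∤ : ∀ {n} → ¬ 3 ∣ n → Leader n
leader-if-3∤ 3∤n (m , n≡3m , _) = 3∤n (divides m (trans n≡3m (*-comm 3 m)))

3∤3*q+1 : ∀ q → ¬ 3 ∣ 3 * q + 1
3∤3*q+1 q 3∣3q+1 with () ← ∣1⇒≡1 (∣m+n∣m⇒∣n 3∣3q+1 (m∣m*n q))

¬leader-if-cheap-3* : ∀ e g → Optimal e → eval e ≡ 3 * eval g → ones g + 3 ≤ ones e → ¬ Leader (eval e)
¬leader-if-cheap-3* e g optimal e≡3g g+3≤e leader with complexity-exists g
... | k , ‖g‖≡k@((h , eval-h , ones-h) , minimal) = leader (eval g , e≡3g , k , ‖g‖≡k , ‖e‖≡3+k)
  where
  open ≤-Reasoning
  ‖e‖≡3+k : Complexity (eval e) (3 + k)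
  ‖e‖≡3+k = (mul three h , trans (cong (3 *_) eval-h) (sym e≡3g) , cong (3 +_) ones-h) ,
    λ e′ eq → begin
      3 + k        ≤⟨ +-monoʳ-≤ 3 (minimal g refl) ⟩
      3 + ones g   ≡⟨ +-comm 3 (ones g) ⟩
      ones g + 3   ≤⟨ g+3≤e ⟩
      ones e       ≤⟨ optimal e′ eq ⟩
      ones e′      ∎

Tight : Expr → Set
Tight e = cube (eval e) ≡ 3 ^ ones e

complexity-suc-tight : ∀ e → Tight e → Complexity (eval e + 1) (ones e + 1)
complexity-suc-tight e tight = (add e one , refl , refl) , minimal
  where
  minimal : ∀ e′ → eval e′ ≡ eval e + 1 → ones e + 1 ≤ ones e′
  minimal e′ eq = subst (_≤ ones e′) (+-comm 1 (ones e)) (^-cancelʳ-< 3 (begin-strict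
    3 ^ ones e          ≡⟨ tight ⟨
    cube (eval e)       <⟨ cube-mono-< (m<m+n (eval e) z<s) ⟩
    cube (eval e + 1)   ≡⟨ cong cube eq ⟨
    cube (eval e′)      ≤⟨ cube≤ (cubeBound-eval e′) ⟩
    3 ^ ones e′         ∎))
    where open ≤-Reasoning

defect-suc-tight : ∀ a b .{{_ : NonZero b}} → b ≤ a → ∀ e → Tight e →
                   3 ^ (b * (ones e + 1)) < 3 ^ a * (eval e + 1) ^ (3 * b)
defect-suc-tight a b b≤a e tight = begin-strict
  3 ^ (b * (ones e + 1))          ≡⟨ ^-*≡^-^ 3 b (ones e + 1) ⟩
  (3 ^ (ones e + 1)) ^ b          ≡⟨ cong (_^ b) (^-distribˡ-+-* 3 (ones e) 1) ⟩
  (3 ^ ones e * 3) ^ b            ≡⟨ ^-distribʳ-* (3 ^ ones e) 3 b ⟩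
  (3 ^ ones e) ^ b * 3 ^ b        ≡⟨ cong (λ c → c ^ b * 3 ^ b) tight ⟨
  cube (eval e) ^ b * 3 ^ b       ≤⟨ *-monoʳ-≤ (cube (eval e) ^ b) (^-monoʳ-≤ 3 b≤a) ⟩
  cube (eval e) ^ b * 3 ^ a       <⟨ *-monoˡ-< (3 ^ a) {{m^n≢0 3 a}} (^-monoˡ-< b (cube-mono-< n<n+1)) ⟩
  cube (eval e + 1) ^ b * 3 ^ a   ≡⟨ *-comm (cube (eval e + 1) ^ b) (3 ^ a) ⟩
  3 ^ a * cube (eval e + 1) ^ b   ≡⟨ cong (3 ^ a *_) (^-3*≡cube-^ (eval e + 1) b) ⟨
  3 ^ a * (eval e + 1) ^ (3 * b)  ∎
  where
  open ≤-Reasoning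
  n<n+1 : eval e < eval e + 1
  n<n+1 = m<m+n (eval e) z<s

power3 : ℕ → Expr
power3 zero    = three
power3 (suc j) = mul three (power3 j)

eval-power3 : ∀ j → eval (power3 j) ≡ 3 ^ suc j
eval-power3 zero    = refl
eval-power3 (suc j) = cong (3 *_) (eval-power3 j)

tight-power3 : ∀ j → Tight (power3 j)
tight-power3 zero    = refl
tight-power3 (suc j) = trans (cube-* 3 (eval (power3 j)))
  (trans (cong (27 *_) (tight-power3 j)) (sym (^-distribˡ-+-* 3 3 (ones (power3 j)))))

<-eval-power3 : ∀ j → j < eval (power3 j)
<-eval-power3 zero    = z<s
<-eval-power3 (suc j) = ≤-<-trans j<v (m<m+n v (≤-trans (<-≤-trans z<s j<v) (m≤m+n v (v + 0))))
  where
  v = eval (power3 j)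
  j<v = <-eval-power3 j

B-infinite : ∀ a b → 0 < b → b ≤ a → InfiniteSet (InB a b)
B-infinite a b 0<b b≤a N =
  eval e + 1 , <⇒≤ (<-≤-trans (<-eval-power3 N) (m≤m+n (eval e) 1)) , leader ,
  (ones e + 1 , complexity-suc-tight e tight , defect-suc-tight a b {{>-nonZero 0<b}} b≤a e tight)
  where
  e = power3 N
  tight = tight-power3 N
  leader : Leader (eval e + 1)
  leader = leader-if-3∤ (subst (λ v → ¬ 3 ∣ v + 1) (sym (eval-power3 N)) (3∤3*q+1 (3 ^ N)))

slack-* : ∀ {r₁ r₂ n₁ n₂ C₁ C₂} → 9 ^ r₁ * cube n₁ ≤ 8 ^ r₁ * C₁ → 9 ^ r₂ * cube n₂ ≤ 8 ^ r₂ * C₂ →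
          9 ^ (r₁ + r₂) * cube (n₁ * n₂) ≤ 8 ^ (r₁ + r₂) * (C₁ * C₂)
slack-* {r₁} {r₂} {n₁} {n₂} {C₁} {C₂} slack₁ slack₂ = begin
  9 ^ (r₁ + r₂) * cube (n₁ * n₂)         ≡⟨ cong₂ _*_ (^-distribˡ-+-* 9 r₁ r₂) (cube-* n₁ n₂) ⟩
  9 ^ r₁ * 9 ^ r₂ * (cube n₁ * cube n₂)  ≡⟨ *-interchange (9 ^ r₁) (9 ^ r₂) (cube n₁) (cube n₂) ⟩
  9 ^ r₁ * cube n₁ * (9 ^ r₂ * cube n₂)  ≤⟨ *-mono-≤ slack₁ slack₂ ⟩
  8 ^ r₁ * C₁ * (8 ^ r₂ * C₂)            ≡⟨ *-interchange (8 ^ r₁) (8 ^ r₂) C₁ C₂ ⟨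
  8 ^ r₁ * 8 ^ r₂ * (C₁ * C₂)            ≡⟨ cong (_* (C₁ * C₂)) (^-distribˡ-+-* 8 r₁ r₂) ⟨
  8 ^ (r₁ + r₂) * (C₁ * C₂)              ∎
  where open ≤-Reasoning

module BoundedB (a b : ℕ) (a<b : a < b) where

  instance
    b≢0 : NonZero b
    b≢0 = >-nonZero (<-≤-trans z<s a<b)

  -- Opaque so that the typechecker never unfolds X ^ r into a polynomial in b.
  opaque
    X : ℕ
    X = 7 + 6 * b

    7+6b≤X : 7 + 6 * b ≤ X
    7+6b≤X = ≤-refl

  instance
    X≢0 : NonZero X
    X≢0 = >-nonZero (≤-trans (s≤s z≤n) 7+6b≤X)

  -- For C = 3^k, where k is the number of 1's of an expression of n, this says
  -- that the defect k − 3 log₃ n of that expression is at least a/b.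
  LargeDefect : ℕ → ℕ → Set
  LargeDefect n C = 3 ^ a * cube n ^ b ≤ C ^ b

  largeDefect-if-3*cube≤ : ∀ {n C} → 3 * cube n ≤ C → LargeDefect n C
  largeDefect-if-3*cube≤ {n} {C} 3n³≤C = begin
    3 ^ a * cube n ^ b   ≤⟨ *-monoˡ-≤ (cube n ^ b) (^-monoʳ-≤ 3 (<⇒≤ a<b)) ⟩
    3 ^ b * cube n ^ b   ≡⟨ ^-distribʳ-* 3 (cube n) b ⟨
    (3 * cube n) ^ b     ≤⟨ ^-monoˡ-≤ b 3n³≤C ⟩
    C ^ b                ∎
    where open ≤-Reasoning

  largeDefect-* : ∀ {n₁ n₂ C₁ C₂} → LargeDefect n₁ C₁ → cube n₂ ≤ C₂ →
                  LargeDefect (n₁ * n₂) (C₁ * C₂)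
  largeDefect-* {n₁} {n₂} {C₁} {C₂} large₁ n₂³≤C₂ = begin
    3 ^ a * cube (n₁ * n₂) ^ b           ≡⟨ cong (λ c → 3 ^ a * c ^ b) (cube-* n₁ n₂) ⟩
    3 ^ a * (cube n₁ * cube n₂) ^ b      ≡⟨ cong (3 ^ a *_) (^-distribʳ-* (cube n₁) (cube n₂) b) ⟩
    3 ^ a * (cube n₁ ^ b * cube n₂ ^ b)  ≡⟨ *-assoc (3 ^ a) (cube n₁ ^ b) (cube n₂ ^ b) ⟨
    3 ^ a * cube n₁ ^ b * cube n₂ ^ b    ≤⟨ *-mono-≤ large₁ (^-monoˡ-≤ b n₂³≤C₂) ⟩
    C₁ ^ b * C₂ ^ b                      ≡⟨ ^-distribʳ-* C₁ C₂ b ⟨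
    (C₁ * C₂) ^ b                        ∎
    where open ≤-Reasoning

  largeDefect-1+ : ∀ y {A B} → 6 * b ≤ y → 3 ≤ A → cube y ≤ B → LargeDefect (1 + y) (A * B)
  largeDefect-1+ y {A} {B} 6b≤y 3≤A y³≤B = begin
    3 ^ a * cube (1 + y) ^ b     ≤⟨ *-monoʳ-≤ (3 ^ a) growth ⟩
    3 ^ a * (3 * cube y ^ b)     ≡⟨ *-assoc (3 ^ a) 3 (cube y ^ b) ⟨
    3 ^ a * 3 * cube y ^ b       ≤⟨ *-monoˡ-≤ (cube y ^ b) 3ᵃ*3≤3ᵇ ⟩
    3 ^ b * cube y ^ b           ≡⟨ ^-distribʳ-* 3 (cube y) b ⟨
    (3 * cube y) ^ b             ≤⟨ ^-monoˡ-≤ b (*-mono-≤ 3≤A y³≤B) ⟩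
    (A * B) ^ b                  ∎
    where
    open ≤-Reasoning
    3ᵃ*3≤3ᵇ : 3 ^ a * 3 ≤ 3 ^ b
    3ᵃ*3≤3ᵇ = subst (_≤ 3 ^ b) (*-comm 3 (3 ^ a)) (^-monoʳ-≤ 3 a<b)
    growth : cube (1 + y) ^ b ≤ 3 * cube y ^ b
    growth = begin
      cube (1 + y) ^ b   ≡⟨ ^-3*≡cube-^ (1 + y) b ⟨
      (1 + y) ^ (3 * b)  ≤⟨ [1+y]^m≤2*y^m (3 * b) y (subst (_≤ y) (*-assoc 2 3 b) 6b≤y) ⟩
      2 * y ^ (3 * b)    ≤⟨ *-monoˡ-≤ (y ^ (3 * b)) (≤ᵇ⇒≤ 2 3 _) ⟩
      3 * y ^ (3 * b)    ≡⟨ cong (3 *_) (^-3*≡cube-^ y b) ⟩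
      3 * cube y ^ b     ∎

  largeDefect-+ : ∀ x y {A B} → CubeBound x A → CubeBound y B → 7 + 6 * b ≤ x + y →
                  LargeDefect (x + y) (A * B)
  largeDefect-+ zero          y             xA _  _  with () ← positive xA
  largeDefect-+ (suc zero)    y             xA yB ≤y+1 =
    largeDefect-1+ y (m+n≤o⇒n≤o 6 (≤-pred ≤y+1)) (3≤ xA) (cube≤ yB)
  largeDefect-+ (suc (suc s)) zero          _  yB _  with () ← positive yB
  largeDefect-+ (suc (suc s)) (suc zero) {A} {B} xA yB ≤x+1 =
    subst₂ LargeDefect (+-comm 1 (2 + s)) (*-comm B A)
      (largeDefect-1+ (2 + s) (m+n≤o⇒n≤o 6 (≤-pred (subst (7 + 6 * b ≤_) (+-comm (2 + s) 1) ≤x+1)))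
        (3≤ yB) (cube≤ xA))
  largeDefect-+ (suc (suc s)) (suc (suc t)) xA yB ≤x+y =
    largeDefect-if-3*cube≤ {2 + s + (2 + t)}
      (3*cube-+≤ (2 + s) (2 + t) xA yB (s≤s (s≤s z≤n)) (s≤s (s≤s z≤n)) (m+n≤o⇒m≤o 7 ≤x+y))

  data Shape (e : Expr) : Set where
    large   : LargeDefect (eval e) (3 ^ ones e) → Shape e
    slack   : (r : ℕ) → eval e ≤ X ^ r → 9 ^ r * cube (eval e) ≤ 8 ^ r * 3 ^ ones e → Shape e
    is3     : eval e ≡ 3 → Shape e
    tripled : (g : Expr) → eval e ≡ 3 * eval g → ones g + 3 ≤ ones e → Shape e

  3^ones-op : ∀ e f → 3 ^ (ones e + ones f) ≡ 3 ^ ones e * 3 ^ ones f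
  3^ones-op e f = ^-distribˡ-+-* 3 (ones e) (ones f)

  shape-add : ∀ e f → Shape (add e f)
  shape-add e f with eval e + eval f ≟ 3 | X ≤? eval e + eval f
  ... | yes ≡3 | _      = is3 ≡3
  ... | no  ≢3 | yes X≤ = large (subst (LargeDefect (eval e + eval f)) (sym (3^ones-op e f))
                            (largeDefect-+ (eval e) (eval f) (cubeBound-eval e) (cubeBound-eval f)
                              (≤-trans 7+6b≤X X≤)))
  ... | no  ≢3 | no  X≰ = slack 1 (≤-trans (<⇒≤ (≰⇒> X≰)) (≤-reflexive (sym (*-identityʳ X))))
                            (subst (λ C → 9 * cube (eval e + eval f) ≤ 8 * C) (sym (3^ones-op e f))
                              (9*cube-+≤8* (eval e) (eval f) (cubeBound-eval e) (cubeBound-eval f) ≢3))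

  shape-mul : ∀ e f → Shape e → Shape f → Shape (mul e f)
  shape-mul e f (large large-e) _ =
    large (subst (LargeDefect (eval e * eval f)) (sym (3^ones-op e f))
      (largeDefect-* {eval e} {eval f} large-e (cube≤ (cubeBound-eval f))))
  shape-mul e f _ (large large-f) =
    large (subst₂ LargeDefect (*-comm (eval f) (eval e))
                               (trans (*-comm (3 ^ ones f) (3 ^ ones e)) (sym (3^ones-op e f)))
      (largeDefect-* {eval f} {eval e} large-f (cube≤ (cubeBound-eval e))))
  shape-mul e f (is3 e≡3) _ =
    tripled f (cong (_* eval f) e≡3)
      (subst (ones f + 3 ≤_) (+-comm (ones f) (ones e)) (+-monoʳ-≤ (ones f) (3≤ones-if-eval≡3 e e≡3)))
  shape-mul e f _ (is3 f≡3) =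
    tripled e (trans (cong (eval e *_) f≡3) (*-comm (eval e) 3)) (+-monoʳ-≤ (ones e) (3≤ones-if-eval≡3 f f≡3))
  shape-mul e f (tripled g e≡3g g+3≤e) _ =
    tripled (mul g f) (trans (cong (_* eval f) e≡3g) (*-assoc 3 (eval g) (eval f)))
      (subst (_≤ ones e + ones f) ([x+y]+z≡[x+z]+y (ones g) 3 (ones f)) (+-monoˡ-≤ (ones f) g+3≤e))
  shape-mul e f _ (tripled g f≡3g g+3≤f) =
    tripled (mul e g) (trans (cong (eval e *_) f≡3g) (x*[y*z]≡y*[x*z] (eval e) 3 (eval g)))
      (subst (_≤ ones e + ones f) (sym (+-assoc (ones e) (ones g) 3)) (+-monoʳ-≤ (ones e) g+3≤f))
  shape-mul e f (slack r₁ e≤ slack-e) (slack r₂ f≤ slack-f) =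
    slack (r₁ + r₂) (subst (eval e * eval f ≤_) (sym (^-distribˡ-+-* X r₁ r₂)) (*-mono-≤ e≤ f≤))
      (subst (λ C → 9 ^ (r₁ + r₂) * cube (eval e * eval f) ≤ 8 ^ (r₁ + r₂) * C) (sym (3^ones-op e f))
        (slack-* {r₁} {r₂} {eval e} {eval f} slack-e slack-f))

  shape : ∀ e → Shape e
  shape one       = slack 1 (subst (1 ≤_) (sym (*-identityʳ X)) (m+n≤o⇒m≤o 1 7+6b≤X)) (≤ᵇ⇒≤ 9 24 _)
  shape (add e f) = shape-add e f
  shape (mul e f) = shape-mul e f (shape e) (shape f)

  slack≤9 : ∀ {r c C} → 9 ^ r * c ≤ 8 ^ r * C → C ^ b < 3 ^ a * c ^ b → r ≤ 9
  slack≤9 {r} {c} {C} slack-c small = ≮⇒≥ λ 9<r → <⇒≱ 9ʳᵇ<8ʳᵇ*3ᵃ (begin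
    (8 ^ r) ^ b * 3 ^ a   ≤⟨ *-monoʳ-≤ ((8 ^ r) ^ b) (^-monoʳ-≤ 3 (<⇒≤ a<b)) ⟩
    (8 ^ r) ^ b * 3 ^ b   ≡⟨ ^-distribʳ-* (8 ^ r) 3 b ⟨
    (8 ^ r * 3) ^ b       ≡⟨ cong (_^ b) (*-comm (8 ^ r) 3) ⟩
    (3 * 8 ^ r) ^ b       ≤⟨ ^-monoˡ-≤ b (3*8^r≤9^r 9<r) ⟩
    (9 ^ r) ^ b           ∎)
    where
    open ≤-Reasoning
    9ʳᵇ<8ʳᵇ*3ᵃ : (9 ^ r) ^ b < (8 ^ r) ^ b * 3 ^ a
    9ʳᵇ<8ʳᵇ*3ᵃ = *-cancelʳ-< (c ^ b) ((9 ^ r) ^ b) ((8 ^ r) ^ b * 3 ^ a) (begin-strict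
      (9 ^ r) ^ b * c ^ b            ≡⟨ ^-distribʳ-* (9 ^ r) c b ⟨
      (9 ^ r * c) ^ b                ≤⟨ ^-monoˡ-≤ b slack-c ⟩
      (8 ^ r * C) ^ b                ≡⟨ ^-distribʳ-* (8 ^ r) C b ⟩
      (8 ^ r) ^ b * C ^ b            <⟨ *-monoʳ-< ((8 ^ r) ^ b) {{m^n≢0 (8 ^ r) b {{m^n≢0 8 r}}}} small ⟩
      (8 ^ r) ^ b * (3 ^ a * c ^ b)  ≡⟨ *-assoc ((8 ^ r) ^ b) (3 ^ a) (c ^ b) ⟨
      (8 ^ r) ^ b * 3 ^ a * c ^ b    ∎)

  optimal-leader-bounded : ∀ e → Optimal e → Leader (eval e) →
                           (3 ^ ones e) ^ b < 3 ^ a * cube (eval e) ^ b → eval e ≤ X ^ 9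
  optimal-leader-bounded e optimal leader small with shape e
  ... | large large-e = contradiction large-e (<⇒≱ small)
  ... | is3 ≡3 =
    subst (_≤ X ^ 9) (sym ≡3) (≤-trans (m+n≤o⇒m≤o 3 7+6b≤X) (m≤m*n X (X ^ 8) {{m^n≢0 X 8}}))
  ... | tripled g e≡3g g+3≤e = contradiction leader (¬leader-if-cheap-3* e g optimal e≡3g g+3≤e)
  ... | slack r e≤Xʳ slack-e = ≤-trans e≤Xʳ (^-monoʳ-≤ X (slack≤9 {r} slack-e small))

  B-bounded : ∀ n → InB a b n → n ≤ X ^ 9
  B-bounded .(eval e) (leader , .(ones e) , ((e , refl , refl) , optimal) , defect) =
    optimal-leader-bounded e optimal leader
      (subst₂ _<_ (^-*≡^-^ 3 b (ones e)) (cong (3 ^ a *_) (^-3*≡cube-^ (eval e) b)) defect)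

B-finite : ∀ a b → a < b → FiniteSet (InB a b)
B-finite a b a<b = suc (X ^ 9) , λ n n∈B → s≤s (B-bounded n n∈B)
  where open BoundedB a b a<b

theorem6p3 : ((a b : ℕ) → 0 < a → a < b → FiniteSet (InB a b))
    × ((a b : ℕ) → 0 < b → b ≤ a → InfiniteSet (InB a b))
theorem6p3 = (λ a b _ → B-finite a b) , B-infinite
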